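{- Let $G$ be a finite loopless bipartite graph, $u\in V(G)$, and $w:V(G)\to\mathbb{N}$ a weight function with $w(x)\ge 1$ for all $x\in V(G)$. Then the \textsc{NimG-RM} position $(G,u,w)$ is winning for the player to move (mis\`ere outcome $\mathcal{N}$) in mis\`ere convention if and only if every maximum matching of $G$ covers $u$.
   Context: \textsc{NimG-RM} is played on a finite undirected graph $G$ with a weight function $w:V(G)\to\mathbb{N}$ ($w(x)$ tokens on $x$) and a pointer on a starting vertex $u$; position $(G,u,w)$. Players alternate; on his turn a player, with the pointer on $x$, removes at least one token from $x$ and then moves the pointer to a neighbour of $x$. A player who starts his turn on a vertex of weight $0$ (or otherwise cannot move) wins under mis\`ere convention. A matching covers $u$ if some edge of the matching is incident to $u$. -}

module Defs where

open import Data.Nat using (ℕ; zero; suc; _≤_; _∸_)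
open import Data.Fin using (Fin; _≟_)
open import Data.Bool using (Bool; true; false; if_then_else_)
open import Data.Product using (Σ; _×_; _,_; ∃)
open import Data.Sum using (_⊎_)
open import Data.List using (List; []; _∷_; length; concatMap)
open import Data.List.Relation.Unary.All using (All)
open import Data.List.Relation.Unary.Any using (Any)
open import Data.List.Relation.Unary.Unique.Propositional using (Unique)
open import Relation.Nullary using (¬_)
open import Relation.Nullary.Decidable using (⌊_⌋)
open import Relation.Binary.PropositionalEquality using (_≡_; _≢_)

record Graph (n : ℕ) : Set where
  field
    adj     : Fin n → Fin n → Bool
    adj-sym : ∀ x y → adj x y ≡ adj y x
    loopless : ∀ x → adj x x ≡ false

open Graph public

Adj : ∀ {n} → Graph n → Fin n → Fin n → Set
Adj G x y = adj G x y ≡ true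

Bipartite : ∀ {n} → Graph n → Set
Bipartite {n} G = Σ (Fin n → Bool) λ c → ∀ x y → Adj G x y → c x ≢ c y

Weight : ℕ → Set
Weight n = Fin n → ℕ

update : ∀ {n} → Weight n → Fin n → ℕ → Weight n
update w x v y = if ⌊ y ≟ x ⌋ then v else w y

-- Outcomes of NimG-RM under misère convention, defined inductively
-- (the game is finite: total weight strictly decreases).
-- Misère: a player who starts his turn on a weight-0 vertex, or otherwise
-- cannot move (pointer vertex has no neighbour), wins.
mutual
  data Win {n : ℕ} (G : Graph n) : Fin n → Weight n → Set where
    win-zero  : ∀ {x w} → w x ≡ 0 → Win G x w
    win-stuck : ∀ {x w} → (∀ y → ¬ Adj G x y) → Win G x w
    win-move  : ∀ {x w} (k : ℕ) (y : Fin n) → 1 ≤ k → k ≤ w x → Adj G x y →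
                Lose G y (update w x (w x ∸ k)) → Win G x w

  data Lose {n : ℕ} (G : Graph n) : Fin n → Weight n → Set where
    lose : ∀ {x w} → 1 ≤ w x → (∃ λ y → Adj G x y) →
           (∀ (k : ℕ) (y : Fin n) → 1 ≤ k → k ≤ w x → Adj G x y →
              Win G y (update w x (w x ∸ k))) →
           Lose G x w

-- Matchings: a list of edges whose endpoints are pairwise distinct
-- (so edges are distinct and vertex-disjoint; size = length).
endpoints : ∀ {n} → List (Fin n × Fin n) → List (Fin n)
endpoints = concatMap (λ { (a , b) → a ∷ b ∷ [] })

IsMatching : ∀ {n} → Graph n → List (Fin n × Fin n) → Set
IsMatching G M = All (λ { (a , b) → Adj G a b }) M × Unique (endpoints M)

IsMaximumMatching : ∀ {n} → Graph n → List (Fin n × Fin n) → Set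
IsMaximumMatching G M =
  IsMatching G M × (∀ M′ → IsMatching G M′ → length M′ ≤ length M)

Covers : ∀ {n} → List (Fin n × Fin n) → Fin n → Set
Covers M u = Any (λ { (a , b) → a ≡ u ⊎ b ≡ u }) M

{-# OPTIONS --safe #-}
module Submission where

-- Fix a maximum matching M. A player who, on a vertex x, empties x and moves to its
-- M-partner drags the pointer along an M-alternating path. By bipartiteness the opponent
-- always lands in the colour class of the start, whose vertices on the path have all been
-- emptied, so he either lands on an empty vertex (and loses) or extends the path by a fresh
-- vertex. That vertex is M-covered, for otherwise switching M along the path would give a
-- maximum matching exposing the start. If every maximum matching covers u, the first player
-- wins this way from u. If a maximum matching exposes u, the second player plays this way
-- from the first player's target s: switching would now expose both u and s, and the edge us
-- would augment a maximum matching.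

open import Defs
open import Data.Nat using (ℕ; _≤_)
open import Data.Fin using (Fin)
open import Data.Product using (_×_; _,_; ∃)
open import Data.List using (List)
open import Function.Bundles using (_⇔_)

open import Data.Bool as Bool using (Bool; true)
open import Data.Bool.Properties using (¬-not)
open import Data.Empty using (⊥; ⊥-elim)
open import Data.Fin using (zero; suc; _≟_)
open import Data.Fin.Properties using (injective⇒≤)
open import Data.Fin.Permutation.Components using (transpose; transpose-inverse)
open import Data.List
  using ( []; _∷_; [_]; length; map; lookup; filter; allFin
        ; cartesianProduct; cartesianProductWith)
open import Data.List.Extrema.Nat using (argmax; argmax-all; f[xs]≤f[argmax])
open import Data.List.Membership.Propositional using (_∈_; _∉_)
open import Data.List.Membership.Propositional.Properties
  using (∈-lookup; ∈-allFin; ∈-cartesianProduct⁺; ∈-cartesianProductWith⁺; ∈-filter⁺)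
open import Data.List.Properties using (length-map)
open import Data.List.Relation.Unary.All as All using (All; []; _∷_)
open import Data.List.Relation.Unary.All.Properties using (¬Any⇒All¬; all-filter)
  renaming (map⁺ to All-map⁺)
open import Data.List.Relation.Unary.Any as Any using (Any; here; there; any?)
open import Data.List.Relation.Unary.AllPairs using ([]; _∷_)
open import Data.List.Relation.Unary.Unique.Propositional using (Unique)
open import Data.List.Relation.Unary.Unique.Propositional.Properties using ()
  renaming (map⁺ to Unique-map⁺)
import Data.List.Relation.Unary.Unique.DecPropositional as UniqueDec
open import Data.Nat using (zero; suc; _<_; _+_; _∸_; z≤n; s≤s)
open import Data.Nat.Induction using (<-wellFounded)
import Data.Nat.Properties as ℕ
open import Data.Product using (proj₁; proj₂)
import Data.Product as Product
open import Data.Sum using (_⊎_; inj₁; inj₂)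
import Data.Sum as Sum
open import Function using (_∘_)
open import Function.Bundles using (mk⇔)
open import Induction.WellFounded using (Acc; acc)
open import Relation.Nullary using (¬_; Dec; yes; no)
open import Relation.Nullary.Decidable
  using (decidable-stable; dec-true; dec-false; _×-dec_; _⊎-dec_)
open import Relation.Binary.PropositionalEquality
  using (_≡_; _≢_; refl; sym; trans; cong; subst; subst₂; module ≡-Reasoning)

private
  variable
    n m : ℕ
    a b s v x y z : Fin n
    V : List (Fin n)
    M : List (Fin n × Fin n)

≢-≢⇒≡ : ∀ {a b c : Bool} → a ≢ b → b ≢ c → a ≡ c
≢-≢⇒≡ a≢b b≢c = trans (¬-not a≢b) (sym (¬-not (b≢c ∘ sym)))

transpose-matchˡ : (i j : Fin n) → transpose i j i ≡ j
transpose-matchˡ i j rewrite dec-true (i ≟ i) refl = refl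

transpose-matchʳ : (i j : Fin n) → transpose i j j ≡ i
transpose-matchʳ i j with j ≟ i
... | yes refl = refl
... | no _ rewrite dec-true (j ≟ j) refl = refl

transpose-other : {i j k : Fin n} → k ≢ i → k ≢ j → transpose i j k ≡ k
transpose-other {i = i} {j} {k} k≢i k≢j
  rewrite dec-false (k ≟ i) k≢i | dec-false (k ≟ j) k≢j = refl

transpose-injective : (i j : Fin n) → transpose i j a ≡ transpose i j b → a ≡ b
transpose-injective {a = a} {b} i j eq = begin
  a                                 ≡⟨ sym (transpose-inverse j i) ⟩
  transpose j i (transpose i j a)   ≡⟨ cong (transpose j i) eq ⟩
  transpose j i (transpose i j b)   ≡⟨ transpose-inverse j i ⟩
  b                                 ∎
  where open ≡-Reasoning

lookup-injective : {A : Set} {xs : List A} → Unique xs →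
                   ∀ {i j} → lookup xs i ≡ lookup xs j → i ≡ j
lookup-injective (_ ∷ _)    {zero}  {zero}  _  = refl
lookup-injective (x∉xs ∷ _) {zero}  {suc j} eq = ⊥-elim (All.lookup x∉xs (∈-lookup j) eq)
lookup-injective (x∉xs ∷ _) {suc i} {zero}  eq = ⊥-elim (All.lookup x∉xs (∈-lookup i) (sym eq))
lookup-injective (_ ∷ uniq) {suc i} {suc j} eq = cong suc (lookup-injective uniq eq)

Unique⇒length≤ : {xs : List (Fin n)} → Unique xs → length xs ≤ n
Unique⇒length≤ uniq = injective⇒≤ (lookup-injective uniq)

module _ {A : Set} where

  lists≤ : List A → ℕ → List (List A)
  lists≤ xs zero    = [ [] ]
  lists≤ xs (suc k) = [] ∷ cartesianProductWith _∷_ xs (lists≤ xs k)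

  ∈-lists≤ : {xs : List A} → (∀ a → a ∈ xs) →
             ∀ {k} (ys : List A) → length ys ≤ k → ys ∈ lists≤ xs k
  ∈-lists≤ _    {zero}  []       _          = here refl
  ∈-lists≤ _    {suc k} []       _          = here refl
  ∈-lists≤ all∈ {suc k} (y ∷ ys) (s≤s len≤) =
    there (∈-cartesianProductWith⁺ _∷_ (all∈ y) (∈-lists≤ all∈ ys len≤))

totalWeight : Weight n → ℕ
totalWeight {zero}  w = 0
totalWeight {suc n} w = w zero + totalWeight (w ∘ suc)

totalWeight-mono-≤ : {v w : Weight n} → (∀ i → v i ≤ w i) → totalWeight v ≤ totalWeight w
totalWeight-mono-≤ {zero}  _   = z≤n
totalWeight-mono-≤ {suc n} v≤w = ℕ.+-mono-≤ (v≤w zero) (totalWeight-mono-≤ (v≤w ∘ suc))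

totalWeight-mono-< : {v w : Weight n} → (∀ i → v i ≤ w i) →
                     ∀ x → v x < w x → totalWeight v < totalWeight w
totalWeight-mono-< v≤w zero    vx<wx = ℕ.+-mono-<-≤ vx<wx (totalWeight-mono-≤ (v≤w ∘ suc))
totalWeight-mono-< v≤w (suc x) vx<wx =
  ℕ.+-mono-≤-< (v≤w zero) (totalWeight-mono-< (v≤w ∘ suc) x vx<wx)

update-≡ : (w : Weight n) (x : Fin n) (k : ℕ) → update w x k x ≡ k
update-≡ w x k with x ≟ x
... | yes _   = refl
... | no x≢x = ⊥-elim (x≢x refl)

update-≢ : (w : Weight n) (k : ℕ) → y ≢ x → update w x k y ≡ w y
update-≢ {y = y} {x} w k y≢x with y ≟ x
... | yes y≡x = ⊥-elim (y≢x y≡x)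
... | no _    = refl

update-∸-≤ : (w : Weight n) (x : Fin n) (k : ℕ) (y : Fin n) → update w x (w x ∸ k) y ≤ w y
update-∸-≤ w x k y with y ≟ x
... | yes refl = ℕ.m∸n≤m (w x) k
... | no _     = ℕ.≤-refl

totalWeight-update-< : (w : Weight n) (x : Fin n) {k : ℕ} → 1 ≤ k → k ≤ w x →
                       totalWeight (update w x (w x ∸ k)) < totalWeight w
totalWeight-update-< w x {k} 1≤k k≤wx =
  totalWeight-mono-< (update-∸-≤ w x k) x
    (subst (_< w x) (sym (update-≡ w x (w x ∸ k))) (ℕ.∸-monoʳ-< 1≤k k≤wx))

module _ {G : Graph n} where

  Win⇒¬Lose : {w : Weight n} → Win G x w → ¬ Lose G x w
  Win⇒¬Lose (win-zero wx≡0)               (lose 1≤wx _ _)     = ℕ.<-irrefl (sym wx≡0) 1≤wx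
  Win⇒¬Lose (win-stuck stuck)             (lose _ (y , xy) _) = stuck y xy
  Win⇒¬Lose (win-move k y 1≤k k≤wx xy lost) (lose _ _ replies)  =
    Win⇒¬Lose (replies k y 1≤k k≤wx xy) lost

  Win-if-positive : {w : Weight n} → (1 ≤ w x → Win G x w) → Win G x w
  Win-if-positive {x = x} {w} win with w x ℕ.≟ 0
  ... | yes wx≡0 = win-zero wx≡0
  ... | no wx≢0  = win (ℕ.n≢0⇒n>0 wx≢0)

Matched : List (Fin n × Fin n) → Fin n → Fin n → Set
Matched M a b = Any (λ e → e ≡ (a , b) ⊎ e ≡ (b , a)) M

Matched-sym : Matched M a b → Matched M b a
Matched-sym = Any.map Sum.swap

Matched⇒Covers : Matched M a b → Covers M a
Matched⇒Covers (here (inj₁ refl)) = here (inj₁ refl)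
Matched⇒Covers (here (inj₂ refl)) = here (inj₂ refl)
Matched⇒Covers (there ab)         = there (Matched⇒Covers ab)

Covers⇒Matched : Covers M a → ∃ (Matched M a)
Covers⇒Matched {M = (p , q) ∷ _} (here (inj₁ refl)) = q , here (inj₁ refl)
Covers⇒Matched {M = (p , q) ∷ _} (here (inj₂ refl)) = p , here (inj₂ refl)
Covers⇒Matched (there cov)                          = Product.map₂ there (Covers⇒Matched cov)

Covers⇒∈endpoints : Covers M a → a ∈ endpoints M
Covers⇒∈endpoints {M = _ ∷ _} (here (inj₁ refl)) = here refl
Covers⇒∈endpoints {M = _ ∷ _} (here (inj₂ refl)) = there (here refl)
Covers⇒∈endpoints {M = _ ∷ _} (there cov)        = there (there (Covers⇒∈endpoints cov))

∈endpoints⇒Covers : a ∈ endpoints M → Covers M a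
∈endpoints⇒Covers {M = _ ∷ _} (here refl)         = here (inj₁ refl)
∈endpoints⇒Covers {M = _ ∷ _} (there (here refl)) = here (inj₂ refl)
∈endpoints⇒Covers {M = _ ∷ _} (there (there a∈)) = there (∈endpoints⇒Covers a∈)

covers? : (M : List (Fin n × Fin n)) (v : Fin n) → Dec (Covers M v)
covers? M v = any? (λ { (p , q) → (p ≟ v) ⊎-dec (q ≟ v) }) M

Matched⇒∈endpoints : Matched M a b → a ∈ endpoints M
Matched⇒∈endpoints = Covers⇒∈endpoints ∘ Matched⇒Covers

length≤length-endpoints : (M : List (Fin n × Fin n)) → length M ≤ length (endpoints M)
length≤length-endpoints []      = z≤n
length≤length-endpoints (_ ∷ M) = s≤s (ℕ.m≤n⇒m≤1+n (length≤length-endpoints M))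

partner-unique : Unique (endpoints M) → Matched M a b → Matched M a z → b ≡ z
partner-unique _               (here (inj₁ refl)) (here (inj₁ refl)) = refl
partner-unique _               (here (inj₂ refl)) (here (inj₂ refl)) = refl
partner-unique ((p≢q ∷ _) ∷ _) (here (inj₁ refl)) (here (inj₂ refl)) = ⊥-elim (p≢q refl)
partner-unique ((p≢q ∷ _) ∷ _) (here (inj₂ refl)) (here (inj₁ refl)) = ⊥-elim (p≢q refl)
partner-unique ((_ ∷ p∉) ∷ _)  (here (inj₁ refl)) (there az)         =
  ⊥-elim (All.lookup p∉ (Matched⇒∈endpoints az) refl)
partner-unique ((_ ∷ p∉) ∷ _)  (there ab)         (here (inj₁ refl)) =
  ⊥-elim (All.lookup p∉ (Matched⇒∈endpoints ab) refl)
partner-unique (_ ∷ q∉ ∷ _)    (here (inj₂ refl)) (there az)         =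
  ⊥-elim (All.lookup q∉ (Matched⇒∈endpoints az) refl)
partner-unique (_ ∷ q∉ ∷ _)    (there ab)         (here (inj₂ refl)) =
  ⊥-elim (All.lookup q∉ (Matched⇒∈endpoints ab) refl)
partner-unique (_ ∷ _ ∷ uniq)  (there ab)         (there az)         = partner-unique uniq ab az

relabel : (Fin n → Fin m) → List (Fin n × Fin n) → List (Fin m × Fin m)
relabel f = map (Product.map f f)

endpoints-relabel : (f : Fin n → Fin m) (M : List (Fin n × Fin n)) →
                    endpoints (relabel f M) ≡ map f (endpoints M)
endpoints-relabel f []            = refl
endpoints-relabel f ((p , q) ∷ M) = cong (λ ends → f p ∷ f q ∷ ends) (endpoints-relabel f M)

Matched-relabel⁺ : (f : Fin n → Fin m) → Matched M a b → Matched (relabel f M) (f a) (f b)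
Matched-relabel⁺ f (here (inj₁ refl)) = here (inj₁ refl)
Matched-relabel⁺ f (here (inj₂ refl)) = here (inj₂ refl)
Matched-relabel⁺ f (there ab)         = there (Matched-relabel⁺ f ab)

Covers-relabel⁻ : {v : Fin m} (f : Fin n → Fin m) → Covers (relabel f M) v →
                  ∃ λ p → Covers M p × f p ≡ v
Covers-relabel⁻ {M = (p , q) ∷ _} f (here (inj₁ fp≡v)) = p , here (inj₁ refl) , fp≡v
Covers-relabel⁻ {M = (p , q) ∷ _} f (here (inj₂ fq≡v)) = q , here (inj₂ refl) , fq≡v
Covers-relabel⁻ {M = _ ∷ _} f (there cov) =
  let p , covp , fp≡v = Covers-relabel⁻ f cov in p , there covp , fp≡v

module _ (G : Graph n) where

  Adj-sym : Adj G a b → Adj G b a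
  Adj-sym {a = a} {b} ab = trans (adj-sym G b a) ab

  Adj-irrefl : Adj G a b → a ≢ b
  Adj-irrefl {a = a} aa refl with trans (sym aa) (loopless G a)
  ... | ()

  Matched⇒Adj : IsMatching G M → Matched M a b → Adj G a b
  Matched⇒Adj (ab ∷ _ , _)              (here (inj₁ refl)) = ab
  Matched⇒Adj (ba ∷ _ , _)              (here (inj₂ refl)) = Adj-sym ba
  Matched⇒Adj (_ ∷ adjs , _ ∷ _ ∷ uniq) (there ab)         = Matched⇒Adj (adjs , uniq) ab

  augment : IsMatching G M → Adj G a b → ¬ Covers M a → ¬ Covers M b →
            IsMatching G ((a , b) ∷ M)
  augment (adjs , uniq) ab a∉M b∉M =
    ab ∷ adjs ,
    (Adj-irrefl ab ∷ ¬Any⇒All¬ _ (a∉M ∘ ∈endpoints⇒Covers)) ∷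
    ¬Any⇒All¬ _ (b∉M ∘ ∈endpoints⇒Covers) ∷
    uniq

  maximum⇒¬exposed-edge : IsMaximumMatching G M → Adj G a b → ¬ Covers M a → ¬ Covers M b → ⊥
  maximum⇒¬exposed-edge (isM , maximal) ab a∉M b∉M =
    ℕ.1+n≰n (maximal _ (augment isM ab a∉M b∉M))

  isMatching? : (M : List (Fin n × Fin n)) → Dec (IsMatching G M)
  isMatching? M =
    All.all? (λ { (a , b) → adj G a b Bool.≟ true }) M ×-dec UniqueDec.unique? _≟_ (endpoints M)

  maximumMatching : ∃ (IsMaximumMatching G)
  maximumMatching = longest , argmax-all length ([] , []) (all-filter isMatching? short) , maximal
    where
    short : List (List (Fin n × Fin n))
    short = lists≤ (cartesianProduct (allFin n) (allFin n)) n
    candidates : List (List (Fin n × Fin n))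
    candidates = filter isMatching? short
    longest : List (Fin n × Fin n)
    longest = argmax length [] candidates
    maximal : ∀ L → IsMatching G L → length L ≤ length longest
    maximal L isL@(_ , uniq) =
      All.lookup (f[xs]≤f[argmax] [] candidates) (∈-filter⁺ isMatching? L∈short isL)
      where
      L∈short : L ∈ short
      L∈short = ∈-lists≤ (λ (a , b) → ∈-cartesianProduct⁺ (∈-allFin a) (∈-allFin b)) L
                  (ℕ.≤-trans (length≤length-endpoints L) (Unique⇒length≤ uniq))

  -- Transposing x with the exposed vertex z replaces the edge x–y of M by z–y
  -- and fixes every other edge.
  module Rematch (isM : IsMatching G M) (xy : Matched M x y) (yz : Adj G y z) (z∉M : ¬ Covers M z)
    where

    τ : Fin n → Fin n
    τ = transpose x z

    rematched : List (Fin n × Fin n)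
    rematched = relabel τ M

    covered≢z : Covers M a → a ≢ z
    covered≢z cov refl = z∉M cov

    τ-fixes-y : τ y ≡ y
    τ-fixes-y = transpose-other (Adj-irrefl (Matched⇒Adj isM (Matched-sym xy))) (Adj-irrefl yz)

    τ-fixes-partner : Matched M x a → τ a ≡ y
    τ-fixes-partner xa = trans (cong τ (partner-unique (proj₂ isM) xa xy)) τ-fixes-y

    τ-Adj : Matched M a b → Adj G (τ a) (τ b)
    τ-Adj {a} {b} = by-cases (a ≟ x) (b ≟ x)
      where
      by-cases : Dec (a ≡ x) → Dec (b ≡ x) → Matched M a b → Adj G (τ a) (τ b)
      by-cases (yes refl) _ ab =
        subst₂ (Adj G) (sym (transpose-matchˡ x z)) (sym (τ-fixes-partner ab)) (Adj-sym yz)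
      by-cases (no _) (yes refl) ab =
        subst₂ (Adj G) (sym (τ-fixes-partner (Matched-sym ab))) (sym (transpose-matchˡ x z)) yz
      by-cases (no a≢x) (no b≢x) ab = subst₂ (Adj G)
        (sym (transpose-other a≢x (covered≢z (Matched⇒Covers ab))))
        (sym (transpose-other b≢x (covered≢z (Matched⇒Covers (Matched-sym ab)))))
        (Matched⇒Adj isM ab)

    isMatching : IsMatching G rematched
    isMatching =
      All-map⁺ (All.tabulate λ { {a , b} ab∈M → τ-Adj (Any.map (inj₁ ∘ sym) ab∈M) }) ,
      subst Unique (sym (endpoints-relabel τ M))
        (Unique-map⁺ (transpose-injective x z) (proj₂ isM))

    exposes-x : ¬ Covers rematched x
    exposes-x cov with Covers-relabel⁻ τ cov
    ... | p , covp , τp≡x = z∉M (subst (Covers M) p≡z covp)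
      where
      p≡z : p ≡ z
      p≡z = transpose-injective x z (trans τp≡x (sym (transpose-matchʳ x z)))

    covers⊆ : Covers rematched v → Covers M v ⊎ v ≡ z
    covers⊆ cov with Covers-relabel⁻ τ cov
    ... | p , covp , refl = by-cases (p ≟ x) covp
      where
      by-cases : Dec (p ≡ x) → Covers M p → Covers M (τ p) ⊎ τ p ≡ z
      by-cases (yes refl) _    = inj₂ (transpose-matchˡ x z)
      by-cases (no p≢x)   covp =
        inj₁ (subst (Covers M) (sym (transpose-other p≢x (covered≢z covp))) covp)

    keeps : Matched M a b → a ≢ x → a ≢ y → Matched rematched a b
    keeps {a} {b} ab a≢x a≢y =
      subst₂ (Matched rematched)
        (transpose-other a≢x (covered≢z (Matched⇒Covers ab)))
        (transpose-other b≢x (covered≢z (Matched⇒Covers (Matched-sym ab))))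
        (Matched-relabel⁺ τ ab)
      where
      b≢x : b ≢ x
      b≢x refl = a≢y (partner-unique (proj₂ isM) (Matched-sym ab) xy)

  -- V lists the vertices visited before x, most recent first; every step follows
  -- an edge of M and then an edge not in M.
  data AltPath (M : List (Fin n × Fin n)) (s : Fin n) : Fin n → List (Fin n) → Set where
    start : AltPath M s s []
    step  : AltPath M s x V → Matched M x y → Adj G y z → y ∉ x ∷ V → z ∉ y ∷ x ∷ V →
            AltPath M s z (y ∷ x ∷ V)

  AltPath-fresh : AltPath M s x V → x ∉ V
  AltPath-fresh (step _ _ _ _ z-fresh) = z-fresh

  AltPath-closed : Unique (endpoints M) → AltPath M s x V → a ∈ V → Matched M a b → b ∈ V
  AltPath-closed uniq (step _ xy _ _ _) (here refl)         ab =
    there (here (partner-unique uniq ab (Matched-sym xy)))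
  AltPath-closed uniq (step _ xy _ _ _) (there (here refl)) ab =
    here (partner-unique uniq ab xy)
  AltPath-closed uniq (step p _ _ _ _)  (there (there a∈V)) ab =
    there (there (AltPath-closed uniq p a∈V ab))

  AltPath-transport : {M′ : List (Fin n × Fin n)} →
                      (∀ {a b} → a ∈ V → Matched M a b → Matched M′ a b) →
                      AltPath M s x V → AltPath M′ s x V
  AltPath-transport kept start = start
  AltPath-transport kept (step p xy yz y-fresh z-fresh) =
    step (AltPath-transport (kept ∘ there ∘ there) p) (kept (there (here refl)) xy) yz y-fresh z-fresh

  record Switched (M : List (Fin n × Fin n)) (s x : Fin n) : Set where
    field
      matching      : List (Fin n × Fin n)
      isMatching    : IsMatching G matching
      length≡       : length matching ≡ length M
      exposes-start : ¬ Covers matching s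
      covers⊆       : ∀ {v} → Covers matching v → Covers M v ⊎ v ≡ x

  switch : IsMatching G M → AltPath M s x V → ¬ Covers M x → Switched M s x
  switch {M = M} isM start s∉M = record
    { matching = M ; isMatching = isM ; length≡ = refl ; exposes-start = s∉M ; covers⊆ = inj₁ }
  switch {M = M} {x = z} isM (step {x = x} {V = V} {y = y} p xy yz y-fresh _) z∉M = record
    { matching      = matching
    ; isMatching    = isMatching
    ; length≡       = trans length≡ (length-map _ M)
    ; exposes-start = exposes-start
    ; covers⊆       = covers⊆′
    }
    where
    module R = Rematch isM xy yz z∉M
    kept : a ∈ V → Matched M a b → Matched R.rematched a b
    kept a∈V ab = R.keeps ab (λ { refl → AltPath-fresh p a∈V }) (λ { refl → y-fresh (there a∈V) })
    open Switched (switch R.isMatching (AltPath-transport kept p) R.exposes-x)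
    covers⊆′ : Covers matching v → Covers M v ⊎ v ≡ z
    covers⊆′ cov with covers⊆ cov
    ... | inj₁ cov′ = R.covers⊆ cov′
    ... | inj₂ refl = inj₁ (Matched⇒Covers xy)

  Switched-maximum : IsMaximumMatching G M → (R : Switched M s x) →
                     IsMaximumMatching G (Switched.matching R)
  Switched-maximum (_ , maximal) R =
    isMatching , λ L isL → subst (length L ≤_) (sym length≡) (maximal L isL)
    where open Switched R

module _ {G : Graph n} (c : Fin n → Bool) (proper : ∀ x y → Adj G x y → c x ≢ c y) where

  same-colour : Adj G x y → Adj G y z → c x ≡ c z
  same-colour {x} {y} {z} xy yz = ≢-≢⇒≡ (proper x y xy) (proper y z yz)

  AltPath-colour : IsMatching G M → AltPath G M s x V → c x ≡ c s
  AltPath-colour isM start              = refl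
  AltPath-colour isM (step p xy yz _ _) =
    trans (sym (same-colour (Matched⇒Adj G isM xy) yz)) (AltPath-colour isM p)

  module MatchingStrategy (isM : IsMatching G M)
                          (ends-covered : ∀ {x V} → AltPath G M s x V → Covers M x) where

    Cleared : Weight n → Fin n → List (Fin n) → Set
    Cleared w x V = ∀ {v} → v ∈ V → c v ≡ c x → w v ≡ 0

    Stocked : Weight n → Fin n → List (Fin n) → Set
    Stocked w x V = ∀ {v} → v ∉ x ∷ V → Covers M v → 1 ≤ w v

    Cleared⇒fresh : {w : Weight n} → Cleared w x V → 1 ≤ w x → x ∉ V
    Cleared⇒fresh cleared 1≤wx x∈V = ℕ.n>0⇒n≢0 1≤wx (cleared x∈V refl)

    Cleared-step : {w w′ : Weight n} → (∀ v → w′ v ≤ w v) → w′ x ≡ 0 → Adj G x y → Adj G y z →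
                   Cleared w x V → Cleared w′ z (y ∷ x ∷ V)
    Cleared-step {y = y} {z} _ _ _ yz _ (here refl) cy≡cz = ⊥-elim (proper y z yz cy≡cz)
    Cleared-step _ w′x≡0 _ _ _ (there (here refl)) _ = w′x≡0
    Cleared-step {w′ = w′} w′≤w _ xy yz cleared {v} (there (there v∈V)) cv≡cz =
      ℕ.n≤0⇒n≡0 (subst (w′ v ≤_) (cleared v∈V (trans cv≡cz (sym (same-colour xy yz)))) (w′≤w v))

    Stocked-step : {w w′ : Weight n} → (∀ {v} → v ≢ x → v ≢ y → w′ v ≡ w v) →
                   Stocked w x V → Stocked w′ z (y ∷ x ∷ V)
    Stocked-step w′≡w stocked v∉ covv =
      subst (1 ≤_) (sym (w′≡w (v∉ ∘ there ∘ there ∘ here) (v∉ ∘ there ∘ here)))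
        (stocked (v∉ ∘ there ∘ there) covv)

    strategy : {w : Weight n} → Acc _<_ (totalWeight w) → AltPath G M s x V → 1 ≤ w x →
               Cleared w x V → Stocked w x V → Win G x w
    strategy {x = x} {V} {w} (acc smaller) p 1≤wx cleared stocked =
      win-move (w x) mate 1≤wx ℕ.≤-refl x~mate (lose 1≤w₁mate (x , Adj-sym G x~mate) reply)
      where
      mate : Fin n
      mate = proj₁ (Covers⇒Matched (ends-covered p))
      x≈mate : Matched M x mate
      x≈mate = proj₂ (Covers⇒Matched (ends-covered p))
      x~mate : Adj G x mate
      x~mate = Matched⇒Adj G isM x≈mate
      mate≢x : mate ≢ x
      mate≢x = Adj-irrefl G x~mate ∘ sym
      mate-fresh : mate ∉ x ∷ V
      mate-fresh (here mate≡x)  = mate≢x mate≡x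
      mate-fresh (there mate∈V) =
        AltPath-fresh G p (AltPath-closed G (proj₂ isM) p mate∈V (Matched-sym x≈mate))
      w₁ : Weight n
      w₁ = update w x (w x ∸ w x)
      1≤w₁mate : 1 ≤ w₁ mate
      1≤w₁mate = subst (1 ≤_) (sym (update-≢ w _ mate≢x))
                   (stocked mate-fresh (Matched⇒Covers (Matched-sym x≈mate)))
      reply : ∀ k z → 1 ≤ k → k ≤ w₁ mate → Adj G mate z → Win G z (update w₁ mate (w₁ mate ∸ k))
      reply k z 1≤k k≤w₁mate mate~z = Win-if-positive λ 1≤w₂z →
        strategy (smaller w₂<w) (step p x≈mate mate~z mate-fresh (Cleared⇒fresh cleared′ 1≤w₂z))
          1≤w₂z cleared′ (Stocked-step w₂≡w stocked)
        where
        w₂ : Weight n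
        w₂ = update w₁ mate (w₁ mate ∸ k)
        w₂<w : totalWeight w₂ < totalWeight w
        w₂<w = ℕ.<-trans (totalWeight-update-< w₁ mate 1≤k k≤w₁mate)
                         (totalWeight-update-< w x 1≤wx ℕ.≤-refl)
        w₂≡w : ∀ {v} → v ≢ x → v ≢ mate → w₂ v ≡ w v
        w₂≡w v≢x v≢mate = trans (update-≢ w₁ _ v≢mate) (update-≢ w _ v≢x)
        w₂x≡0 : w₂ x ≡ 0
        w₂x≡0 = begin
          w₂ x      ≡⟨ update-≢ w₁ _ (mate≢x ∘ sym) ⟩
          w₁ x      ≡⟨ update-≡ w x (w x ∸ w x) ⟩
          w x ∸ w x ≡⟨ ℕ.n∸n≡0 (w x) ⟩
          0         ∎
          where open ≡-Reasoning
        cleared′ : Cleared w₂ z (mate ∷ x ∷ V)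
        cleared′ = Cleared-step (λ v → ℕ.≤-trans (update-∸-≤ w₁ mate k v) (update-∸-≤ w x (w x) v))
                     w₂x≡0 x~mate mate~z cleared

module _ (G : Graph n) (c : Fin n → Bool) (proper : ∀ x y → Adj G x y → c x ≢ c y)
         (u : Fin n) {w : Weight n} (w-positive : ∀ x → 1 ≤ w x) where

  allCovered⇒Win : IsMaximumMatching G M → (∀ M′ → IsMaximumMatching G M′ → Covers M′ u) →
                   Win G u w
  allCovered⇒Win {M} maxM all-cover =
    strategy (<-wellFounded _) start (w-positive u) (λ ()) (λ _ _ → w-positive _)
    where
    ends-covered : AltPath G M u x V → Covers M x
    ends-covered {x} p = decidable-stable (covers? M x) λ x∉M →
      let R = switch G (proj₁ maxM) p x∉M in
      Switched.exposes-start R (all-cover _ (Switched-maximum G maxM R))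
    open MatchingStrategy c proper (proj₁ maxM) ends-covered

  exposed⇒Lose : IsMaximumMatching G M → ¬ Covers M u → ∃ (Adj G u) → Lose G u w
  exposed⇒Lose {M} maxM u∉M has-neighbour = lose (w-positive u) has-neighbour reply
    where
    reply : ∀ k s → 1 ≤ k → k ≤ w u → Adj G u s → Win G s (update w u (w u ∸ k))
    reply k s _ _ u~s = Win-if-positive λ 1≤w₁s →
      strategy (<-wellFounded _) start 1≤w₁s (λ ()) stocked
      where
      u-exposed : (R : Switched G M s x) → AltPath G M s x V → ¬ Covers (Switched.matching R) u
      u-exposed R p cov with Switched.covers⊆ R cov
      ... | inj₁ covu = u∉M covu
      ... | inj₂ refl = proper u s u~s (AltPath-colour c proper (proj₁ maxM) p)
      ends-covered : AltPath G M s x V → Covers M x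
      ends-covered {x} p = decidable-stable (covers? M x) λ x∉M →
        let R = switch G (proj₁ maxM) p x∉M in
        maximum⇒¬exposed-edge G (Switched-maximum G maxM R) u~s (u-exposed R p)
          (Switched.exposes-start R)
      open MatchingStrategy c proper (proj₁ maxM) ends-covered
      stocked : Stocked (update w u (w u ∸ k)) s []
      stocked {v} _ covv = subst (1 ≤_) (sym (update-≢ w _ λ { refl → u∉M covv })) (w-positive v)

theorem7 : ∀ {n : ℕ} (G : Graph n) → Bipartite G →
           (u : Fin n) → (∃ λ y → Adj G u y) →
           (w : Weight n) → (∀ x → 1 ≤ w x) →
           Win G u w ⇔ (∀ (M : List (Fin n × Fin n)) → IsMaximumMatching G M → Covers M u)
theorem7 G (c , proper) u has-neighbour w w-positive = mk⇔
  (λ win M maxM → decidable-stable (covers? M u) λ u∉M →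
     Win⇒¬Lose win (exposed⇒Lose G c proper u w-positive maxM u∉M has-neighbour))
  (allCovered⇒Win G c proper u w-positive (proj₂ (maximumMatching G)))
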